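{- For every integer $n \geq 12$ with $n \equiv 0$ or $1 \pmod 4$, there exists a dually vertex-oblique graph on $n$ vertices that is a split graph.
   Context: All graphs are finite and simple. For a vertex $v$ of degree $r$ in a graph $G$ whose neighbours have degrees $x_1 \geq \cdots \geq x_r$ (degrees taken in $G$), the vertex type of $v$ in $G$ is the sequence $t(v) := (x_1,\ldots,x_r)$. A graph is vertex-oblique if distinct vertices have distinct vertex types. A graph $G$ is dually vertex-oblique if it is vertex-oblique and the set of vertex types of $G$ equals the set of vertex types of its complement $\overline{G}$ (vertex types in $\overline{G}$ computed in $\overline{G}$). A graph is split if its vertex set can be partitioned into two sets $L$ and $R$ such that $L$ induces an edgeless graph and $R$ induces a complete graph. -}

module Defs where

open import Data.Bool using (Bool; true; false; not; if_then_else_)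
import Data.Bool as B
open import Data.Nat using (ℕ)
open import Data.Nat.Properties using (≤-decTotalOrder)
open import Data.Fin using (Fin; _≟_)
open import Data.List using (List; length; filter; map; reverse; allFin)
open import Data.Product using (Σ; ∃; _×_)
open import Relation.Binary.PropositionalEquality using (_≡_; _≢_; refl; sym; cong)
open import Data.Empty using (⊥-elim)
open import Relation.Nullary using (does; yes; no)
open import Relation.Nullary.Decidable using (⌊_⌋)
import Data.List.Sort as Sort

record Graph (n : ℕ) : Set where
  field
    adj    : Fin n → Fin n → Bool
    adj-sym    : ∀ i j → adj i j ≡ adj j i
    adj-irrefl : ∀ i → adj i i ≡ false
open Graph public

complement : ∀ {n} → Graph n → Graph n
complement {n} G = record
  { adj    = λ i j → if ⌊ i ≟ j ⌋ then false else not (adj G i j)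
  ; adj-sym    = symC
  ; adj-irrefl = irrC }
  where
  symC : ∀ i j → (if ⌊ i ≟ j ⌋ then false else not (adj G i j))
               ≡ (if ⌊ j ≟ i ⌋ then false else not (adj G j i))
  symC i j with i ≟ j | j ≟ i
  ... | yes _ | yes _ = refl
  ... | yes p | no q = ⊥-elim (q (sym p))
  ... | no p | yes q = ⊥-elim (p (sym q))
  ... | no _ | no _ = cong not (adj-sym G i j)
  irrC : ∀ i → (if ⌊ i ≟ i ⌋ then false else not (adj G i i)) ≡ false
  irrC i with i ≟ i
  ... | yes _ = refl
  ... | no p = ⊥-elim (p refl)

neighbours : ∀ {n} → Graph n → Fin n → List (Fin n)
neighbours {n} G v = filter (λ u → adj G v u B.≟ true) (allFin n)

degree : ∀ {n} → Graph n → Fin n → ℕ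
degree G v = length (neighbours G v)

vertexType : ∀ {n} → Graph n → Fin n → List ℕ
vertexType G v = reverse (sort (map (degree G) (neighbours G v)))
  where open Sort ≤-decTotalOrder using (sort)

VertexOblique : ∀ {n} → Graph n → Set
VertexOblique G = ∀ u v → vertexType G u ≡ vertexType G v → u ≡ v

SameTypeSets : ∀ {n} → Graph n → Graph n → Set
SameTypeSets {n} G H =
  (∀ u → ∃ λ (v : Fin n) → vertexType G u ≡ vertexType H v) ×
  (∀ v → ∃ λ (u : Fin n) → vertexType H v ≡ vertexType G u)

DuallyVertexOblique : ∀ {n} → Graph n → Set
DuallyVertexOblique G = VertexOblique G × SameTypeSets G (complement G)

IsSplit : ∀ {n} → Graph n → Set
IsSplit {n} G = Σ (Fin n → Bool) λ inL →
  (∀ u v → inL u ≡ true → inL v ≡ true → adj G u v ≡ false) ×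
  (∀ u v → inL u ≡ false → inL v ≡ false → u ≢ v → adj G u v ≡ true)

-- Write n = 4m + r with m ≥ 3 and r ∈ {0, 1}. Take an independent set of 2m vertices
-- left a i and a clique of 2m vertices right b j (a, b : Bool, i, j < m), plus, when r = 1,
-- an apex joined to the whole clique. Whether left a i and right b j are adjacent depends only
-- on a, b and the position of j relative to i, through a pattern that is antisymmetric:
-- exchanging the roles of the two endpoints complements it. Consequently, swapping the two
-- sides, after exchanging the two vertices opposite v, maps the neighbourhood of v in G onto
-- the neighbourhood of its mirror image in the complement. The degrees of a vertex and of its
-- mirror image add up to n − 1, so this map also matches degrees in G with degrees in the
-- complement, and G and its complement have the same vertex types.
-- The twins left false i and left true i (and likewise on the right) have equal degree; the
-- degrees of different rows are distinct, those of left vertices lie below 2m = deg(apex) and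
-- those of right vertices above it. So the degree determines a vertex up to its twin, and twins
-- are told apart by how many neighbours they have of one well-chosen degree.

module Submission where

open import Defs
open import Data.Bool as Bool using (Bool; true; false; not; _∧_; _xor_; if_then_else_; T)
open import Data.Bool.Properties using (∧-zeroʳ; ∧-identityʳ; not-involutive; not-distribˡ-xor; not-distribʳ-xor; xor-comm; xor-assoc; xor-same)
open import Data.Empty using (⊥-elim)
open import Data.Fin as Fin using (Fin; toℕ; _↑ˡ_; _↑ʳ_; _≟_; splitAt; fromℕ<)
open import Data.Fin.Properties using (splitAt-↑ˡ; splitAt-↑ʳ; splitAt⁻¹-↑ˡ; splitAt⁻¹-↑ʳ; toℕ<n; toℕ-injective; toℕ-fromℕ<)
open import Data.Fin.Permutation using (Permutation′; permutation; _⟨$⟩ʳ_; _⟨$⟩ˡ_; inverseˡ; inverseʳ)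
open import Data.List using (List; []; _∷_; map; filter; length; reverse; tabulate; allFin)
open import Data.List.Properties using (length-map; reverse-injective; filter-≐; map-cong; map-∘)
open import Data.List.Membership.Propositional using (_∈_)
open import Data.List.Membership.Propositional.Properties using (∈-allFin; ∈-map⁺)
open import Data.List.Membership.Propositional.Properties.WithK using (unique∧set⇒bag)
open import Data.List.Relation.Binary.BagAndSetEquality using (∼bag⇒↭)
open import Data.List.Relation.Binary.Permutation.Propositional using (_↭_; ↭-sym; ↭-trans; ↭⇒↭ₛ; module PermutationReasoning)
open import Data.List.Relation.Binary.Permutation.Propositional.Properties as PP using (↭-length; filter-↭)
import Data.List.Relation.Binary.Pointwise as Pointwise
open import Data.List.Relation.Unary.Sorted.TotalOrder.Properties using (↗↭↗⇒≋)
open import Data.List.Relation.Unary.Unique.Propositional.Properties as Unique using ()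
import Data.List.Sort as Sort
open import Data.Nat as ℕ using (ℕ; zero; suc; _+_; _*_; _∸_; _≡ᵇ_; _≤_; _<_; _%_; _/_; z≤n; s≤s)
open import Data.Nat.DivMod using (m≡m%n+[m/n]*n; /-monoˡ-≤)
open import Data.Nat.Properties using (+-assoc; +-suc; +-comm; +-identityʳ; ≤-decTotalOrder; ≤-totalOrder; ≡ᵇ⇒≡; suc-injective; +-cancelˡ-≡; +-cancelʳ-≡; even≢odd; *-cancelˡ-≡; m+1+n≢0; ≤-reflexive; ≤-trans; +-mono-≤; n≤1+n; m≤n+m; <-trans; n<1+n; m≤n⇒m<n∨m≡n; ≤-pred; m+[n∸m]≡n; m∸n+n≡m; m+n∸m≡n; +-monoʳ-≤; +-monoˡ-≤; m≤m+n; ∸-cancelˡ-≡; <⇒≢; +-cancelˡ-≤; module ≤-Reasoning)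
open import Data.Nat.Solver using (module +-*-Solver)
open import Data.Product using (Σ; ∃-syntax; _×_; _,_)
open import Data.Sum using (_⊎_; inj₁; inj₂; [_,_]′)
open import Data.Unit using (tt)
open import Function using (_∘_; id; flip; mk⇔)
open import Relation.Nullary using (yes; no)
open import Relation.Nullary.Decidable using (⌊_⌋; ⌊⌋-map′)
open import Relation.Binary.PropositionalEquality

open Sort ≤-decTotalOrder using (sort; sort-↭; sort-↗)

-- Counting

bit : Bool → ℕ
bit true  = 1
bit false = 0

count : ∀ {n} → (Fin n → Bool) → ℕ
count {zero}  p = 0
count {suc n} p = bit (p Fin.zero) + count (p ∘ Fin.suc)

count-cong : ∀ {n} {p q : Fin n → Bool} → (∀ i → p i ≡ q i) → count p ≡ count q
count-cong {zero}  p≗q = refl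
count-cong {suc n} p≗q = cong₂ _+_ (cong bit (p≗q Fin.zero)) (count-cong (p≗q ∘ Fin.suc))

count-false : ∀ n → count {n} (λ _ → false) ≡ 0
count-false zero    = refl
count-false (suc n) = count-false n

count-true : ∀ n → count {n} (λ _ → true) ≡ n
count-true zero    = refl
count-true (suc n) = cong suc (count-true n)

count-const : ∀ n b → count {n} (λ _ → b) ≡ (if b then n else 0)
count-const n true  = count-true n
count-const n false = count-false n

count-+ : ∀ m {k} (p : Fin (m + k) → Bool) →
          count p ≡ count (p ∘ (_↑ˡ k)) + count (p ∘ (m ↑ʳ_))
count-+ zero    p = refl
count-+ (suc m) p = trans (cong (bit (p Fin.zero) +_) (count-+ m (p ∘ Fin.suc)))
                          (sym (+-assoc (bit (p Fin.zero)) _ _))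

count-not : ∀ {n} (p : Fin n → Bool) → count (not ∘ p) + count p ≡ n
count-not {zero}  p = refl
count-not {suc n} p = begin
  (bit (not b) + count (not ∘ p ∘ Fin.suc)) + (bit b + count (p ∘ Fin.suc))
    ≡⟨ interchange (bit (not b)) _ (bit b) _ ⟩
  (bit (not b) + bit b) + (count (not ∘ p ∘ Fin.suc) + count (p ∘ Fin.suc))
    ≡⟨ cong₂ _+_ (bit-not b) (count-not (p ∘ Fin.suc)) ⟩
  suc n ∎
  where
  open ≡-Reasoning
  b = p Fin.zero
  bit-not : ∀ b → bit (not b) + bit b ≡ 1
  bit-not true  = refl
  bit-not false = refl
  interchange : ∀ a x c y → (a + x) + (c + y) ≡ (a + c) + (x + y)
  interchange = solve 4 (λ a x c y → (a :+ x) :+ (c :+ y) := (a :+ c) :+ (x :+ y)) refl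
    where open +-*-Solver

count-point : ∀ {n} (q : Fin n → Bool) (i : Fin n) → count (λ j → q j ∧ ⌊ j ≟ i ⌋) ≡ bit (q i)
count-point {suc n} q Fin.zero = begin
  bit (q Fin.zero ∧ true) + count (λ j → q (Fin.suc j) ∧ false)
    ≡⟨ cong₂ _+_ (cong bit (∧-identityʳ (q Fin.zero)))
                 (trans (count-cong (λ j → ∧-zeroʳ (q (Fin.suc j)))) (count-false n)) ⟩
  bit (q Fin.zero) + 0
    ≡⟨ +-identityʳ _ ⟩
  bit (q Fin.zero) ∎
  where open ≡-Reasoning
count-point {suc n} q (Fin.suc i) = begin
  bit (q Fin.zero ∧ false) + count (λ j → q (Fin.suc j) ∧ ⌊ Fin.suc j ≟ Fin.suc i ⌋)
    ≡⟨ cong₂ _+_ (cong bit (∧-zeroʳ (q Fin.zero)))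
                 (count-cong (λ j → cong (q (Fin.suc j) ∧_) (⌊⌋-map′ _ _ (j ≟ i)))) ⟩
  count (λ j → q (Fin.suc j) ∧ ⌊ j ≟ i ⌋)
    ≡⟨ count-point (q ∘ Fin.suc) i ⟩
  bit (q (Fin.suc i)) ∎
  where open ≡-Reasoning

count-remove : ∀ {n} (p : Fin n → Bool) (i : Fin n) →
               count (λ j → if ⌊ i ≟ j ⌋ then false else p j) + bit (p i) ≡ count p
count-remove {suc n} p Fin.zero = +-comm (count (p ∘ Fin.suc)) (bit (p Fin.zero))
count-remove {suc n} p (Fin.suc i) = trans (+-assoc (bit (p Fin.zero)) _ _)
  (cong (bit (p Fin.zero) +_) (trans (cong (_+ bit (p (Fin.suc i))) (count-cong ⌊suc≟suc⌋))
                                     (count-remove (p ∘ Fin.suc) i)))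
  where
  ⌊suc≟suc⌋ : ∀ j → (if ⌊ Fin.suc i ≟ Fin.suc j ⌋ then false else p (Fin.suc j))
                   ≡ (if ⌊ i ≟ j ⌋ then false else p (Fin.suc j))
  ⌊suc≟suc⌋ j = cong (if_then false else p (Fin.suc j)) (⌊⌋-map′ _ _ (i ≟ j))

block : ∀ {A : Set} {a b} → (Fin a → A) → (Fin b → A) → Fin (a + b) → A
block {a = a} f g i = [ f , g ]′ (splitAt a i)

module _ {A : Set} {a b : ℕ} (f : Fin a → A) (g : Fin b → A) where

  block-↑ˡ : ∀ i → block f g (i ↑ˡ b) ≡ f i
  block-↑ˡ i = cong [ f , g ]′ (splitAt-↑ˡ a i b)

  block-↑ʳ : ∀ j → block f g (a ↑ʳ j) ≡ g j
  block-↑ʳ j = cong [ f , g ]′ (splitAt-↑ʳ a b j)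

  count-block : (q : A → Bool) → count (q ∘ block f g) ≡ count (q ∘ f) + count (q ∘ g)
  count-block q = trans (count-+ a (q ∘ block f g))
    (cong₂ _+_ (count-cong (cong q ∘ block-↑ˡ)) (count-cong (cong q ∘ block-↑ʳ)))

  block-unique : ∀ {C : Set} (e : A → C) (h : Fin (a + b) → C) →
                 (∀ i → e (f i) ≡ h (i ↑ˡ b)) → (∀ j → e (g j) ≡ h (a ↑ʳ j)) →
                 ∀ k → e (block f g k) ≡ h k
  block-unique e h ef eg k with splitAt a k in eq
  ... | inj₁ i = trans (ef i) (cong h (splitAt⁻¹-↑ˡ eq))
  ... | inj₂ j = trans (eg j) (cong h (splitAt⁻¹-↑ʳ eq))

-- Vertex types

filterᵇ : ∀ {A : Set} → (A → Bool) → List A → List A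
filterᵇ q = filter (λ x → q x Bool.≟ true)

length-filterᵇ-tabulate : ∀ {A : Set} {n} (q : A → Bool) (f : Fin n → A) →
                          length (filterᵇ q (tabulate f)) ≡ count (q ∘ f)
length-filterᵇ-tabulate {n = zero}  q f = refl
length-filterᵇ-tabulate {n = suc n} q f with q (f Fin.zero)
... | true  = cong suc (length-filterᵇ-tabulate q (f ∘ Fin.suc))
... | false = length-filterᵇ-tabulate q (f ∘ Fin.suc)

filterᵇ-map : ∀ {A B : Set} (q : B → Bool) (f : A → B) (xs : List A) →
              filterᵇ q (map f xs) ≡ map f (filterᵇ (q ∘ f) xs)
filterᵇ-map q f []       = refl
filterᵇ-map q f (x ∷ xs) with q (f x)
... | true  = cong (f x ∷_) (filterᵇ-map q f xs)
... | false = filterᵇ-map q f xs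

filterᵇ-filterᵇ : ∀ {A : Set} (p q : A → Bool) (xs : List A) →
                  filterᵇ q (filterᵇ p xs) ≡ filterᵇ (λ x → p x ∧ q x) xs
filterᵇ-filterᵇ p q []       = refl
filterᵇ-filterᵇ p q (x ∷ xs) with p x
... | false = filterᵇ-filterᵇ p q xs
... | true with q x
...   | true  = cong (x ∷_) (filterᵇ-filterᵇ p q xs)
...   | false = filterᵇ-filterᵇ p q xs

filterᵇ-cong : ∀ {A : Set} {p q : A → Bool} → (∀ x → p x ≡ q x) → ∀ xs → filterᵇ p xs ≡ filterᵇ q xs
filterᵇ-cong p≗q = filter-≐ _ _ ((λ {x} e → trans (sym (p≗q x)) e) , (λ {x} e → trans (p≗q x) e))

length-filterᵇ-allFin : ∀ {n} (q : Fin n → Bool) → length (filterᵇ q (allFin n)) ≡ count q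
length-filterᵇ-allFin q = length-filterᵇ-tabulate q (λ i → i)

sort-↭⇒≡ : ∀ {xs ys : List ℕ} → xs ↭ ys → sort xs ≡ sort ys
sort-↭⇒≡ {xs} {ys} xs↭ys = Pointwise.Pointwise-≡⇒≡ (↗↭↗⇒≋ ≤-totalOrder (sort-↗ xs) (sort-↗ ys)
  (↭⇒↭ₛ (↭-trans (sort-↭ xs) (↭-trans xs↭ys (↭-sym (sort-↭ ys))))))

sort-≡⇒↭ : ∀ {xs ys : List ℕ} → sort xs ≡ sort ys → xs ↭ ys
sort-≡⇒↭ {xs} {ys} eq = ↭-trans (↭-sym (sort-↭ xs)) (subst (_↭ ys) (sym eq) (sort-↭ ys))

map-allFin-↭ : ∀ {n} (π : Permutation′ n) → map (π ⟨$⟩ʳ_) (allFin n) ↭ allFin n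
map-allFin-↭ {n} π = ∼bag⇒↭ (unique∧set⇒bag
  (Unique.map⁺ (λ eq → trans (sym (inverseˡ π)) (trans (cong (π ⟨$⟩ˡ_) eq) (inverseˡ π))) (Unique.allFin⁺ n))
  (Unique.allFin⁺ n)
  (λ {i} → mk⇔ (λ _ → ∈-allFin i) (λ _ → subst (_∈ _) (inverseʳ π) (∈-map⁺ (π ⟨$⟩ʳ_) (∈-allFin (π ⟨$⟩ˡ i))))))

neighbourDegrees : ∀ {n} → Graph n → Fin n → List ℕ
neighbourDegrees G v = map (degree G) (neighbours G v)

degree-count : ∀ {n} (G : Graph n) v → degree G v ≡ count (adj G v)
degree-count G v = length-filterᵇ-allFin (adj G v)

module _ {n : ℕ} (G : Graph n) where

  neighbourDegrees-count : ∀ (q : ℕ → Bool) v →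
    length (filterᵇ q (neighbourDegrees G v)) ≡ count (λ w → adj G v w ∧ q (degree G w))
  neighbourDegrees-count q v = begin
    length (filterᵇ q (map (degree G) (neighbours G v)))
      ≡⟨ cong length (filterᵇ-map q (degree G) (neighbours G v)) ⟩
    length (map (degree G) (filterᵇ (q ∘ degree G) (neighbours G v)))
      ≡⟨ length-map (degree G) (filterᵇ (q ∘ degree G) (neighbours G v)) ⟩
    length (filterᵇ (q ∘ degree G) (filterᵇ (adj G v) (allFin n)))
      ≡⟨ cong length (filterᵇ-filterᵇ (adj G v) (q ∘ degree G) (allFin n)) ⟩
    length (filterᵇ (λ w → adj G v w ∧ q (degree G w)) (allFin n))
      ≡⟨ length-filterᵇ-allFin (λ w → adj G v w ∧ q (degree G w)) ⟩
    count (λ w → adj G v w ∧ q (degree G w)) ∎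
    where open ≡-Reasoning

  degree-complement : ∀ v → degree (complement G) v + suc (degree G v) ≡ n
  degree-complement v = begin
    degree (complement G) v + suc (degree G v)
      ≡⟨ cong₂ (λ x y → x + suc y) (degree-count (complement G) v) (degree-count G v) ⟩
    count (adj (complement G) v) + suc (count (adj G v))
      ≡⟨ +-suc _ _ ⟩
    suc (count (adj (complement G) v) + count (adj G v))
      ≡⟨ cong (λ b → bit (not b) + count (adj (complement G) v) + count (adj G v)) (adj-irrefl G v) ⟨
    bit (not (adj G v v)) + count (adj (complement G) v) + count (adj G v)
      ≡⟨ cong (_+ count (adj G v)) (trans (+-comm (bit (not (adj G v v))) _)
                                          (count-remove (not ∘ adj G v) v)) ⟩
    count (not ∘ adj G v) + count (adj G v)
      ≡⟨ count-not (adj G v) ⟩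
    n ∎
    where open ≡-Reasoning

↭⇒vertexType-≡ : ∀ {n} {G H : Graph n} {u v} →
  neighbourDegrees G u ↭ neighbourDegrees H v → vertexType G u ≡ vertexType H v
↭⇒vertexType-≡ p = cong reverse (sort-↭⇒≡ p)

vertexType-≡⇒↭ : ∀ {n} {G H : Graph n} {u v} →
  vertexType G u ≡ vertexType H v → neighbourDegrees G u ↭ neighbourDegrees H v
vertexType-≡⇒↭ eq = sort-≡⇒↭ (reverse-injective eq)

module _ {n : ℕ} (G : Graph n) {u v : Fin n} (same-type : vertexType G u ≡ vertexType G v) where

  vertexType-≡⇒degree-≡ : degree G u ≡ degree G v
  vertexType-≡⇒degree-≡ = begin
    degree G u                       ≡⟨ length-map (degree G) (neighbours G u) ⟨
    length (neighbourDegrees G u)    ≡⟨ ↭-length (vertexType-≡⇒↭ {G = G} {G} same-type) ⟩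
    length (neighbourDegrees G v)    ≡⟨ length-map (degree G) (neighbours G v) ⟩
    degree G v ∎
    where open ≡-Reasoning

  vertexType-≡⇒count-≡ : ∀ (q : ℕ → Bool) →
    count (λ w → adj G u w ∧ q (degree G w)) ≡ count (λ w → adj G v w ∧ q (degree G w))
  vertexType-≡⇒count-≡ q = begin
    count (λ w → adj G u w ∧ q (degree G w))        ≡⟨ neighbourDegrees-count G q u ⟨
    length (filterᵇ q (neighbourDegrees G u))
      ≡⟨ ↭-length (filter-↭ (λ d → q d Bool.≟ true) (vertexType-≡⇒↭ {G = G} {G} same-type)) ⟩
    length (filterᵇ q (neighbourDegrees G v))       ≡⟨ neighbourDegrees-count G q v ⟩
    count (λ w → adj G v w ∧ q (degree G w)) ∎
    where open ≡-Reasoning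

module _ {n : ℕ} (G H : Graph n) (π : Permutation′ n) {u v : Fin n}
         (π-adj : ∀ w → adj H v (π ⟨$⟩ʳ w) ≡ adj G u w) where

  neighbours-↭ : neighbours H v ↭ map (π ⟨$⟩ʳ_) (neighbours G u)
  neighbours-↭ = begin
    filterᵇ (adj H v) (allFin n)                        ↭⟨ filter-↭ (λ w → adj H v w Bool.≟ true) (map-allFin-↭ π) ⟨
    filterᵇ (adj H v) (map (π ⟨$⟩ʳ_) (allFin n))        ≡⟨ filterᵇ-map (adj H v) (π ⟨$⟩ʳ_) (allFin n) ⟩
    map (π ⟨$⟩ʳ_) (filterᵇ (adj H v ∘ (π ⟨$⟩ʳ_)) (allFin n)) ≡⟨ cong (map (π ⟨$⟩ʳ_)) (filterᵇ-cong π-adj (allFin n)) ⟩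
    map (π ⟨$⟩ʳ_) (neighbours G u) ∎
    where open PermutationReasoning

  degree-preserved : degree H v ≡ degree G u
  degree-preserved = trans (↭-length neighbours-↭) (length-map (π ⟨$⟩ʳ_) (neighbours G u))

  vertexType-preserved : (∀ w → degree H (π ⟨$⟩ʳ w) ≡ degree G w) → vertexType H v ≡ vertexType G u
  vertexType-preserved π-degree = ↭⇒vertexType-≡ {G = H} {G} (begin
    map (degree H) (neighbours H v)                     ↭⟨ PP.map⁺ (degree H) neighbours-↭ ⟩
    map (degree H) (map (π ⟨$⟩ʳ_) (neighbours G u))     ≡⟨ map-∘ (neighbours G u) ⟨
    map (degree H ∘ (π ⟨$⟩ʳ_)) (neighbours G u)         ≡⟨ map-cong π-degree (neighbours G u) ⟩
    map (degree G) (neighbours G u) ∎)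
    where open PermutationReasoning

if-≢ : ∀ {n} {i j : Fin n} (x : Bool) → i ≢ j → (if ⌊ i ≟ j ⌋ then false else x) ≡ x
if-≢ {i = i} {j} x i≢j with i ≟ j
... | yes i≡j = ⊥-elim (i≢j i≡j)
... | no  _   = refl

fromSymmetric : ∀ {n} (r : Fin n → Fin n → Bool) → (∀ i j → r i j ≡ r j i) → Graph n
fromSymmetric r r-sym = record
  { adj        = λ i j → if ⌊ i ≟ j ⌋ then false else r i j
  ; adj-sym    = adj-sym′
  ; adj-irrefl = adj-irrefl′
  }
  where
  adj-sym′ : ∀ i j → (if ⌊ i ≟ j ⌋ then false else r i j) ≡ (if ⌊ j ≟ i ⌋ then false else r j i)
  adj-sym′ i j with i ≟ j | j ≟ i
  ... | yes _   | yes _   = refl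
  ... | yes i≡j | no  j≢i = ⊥-elim (j≢i (sym i≡j))
  ... | no  i≢j | yes j≡i = ⊥-elim (i≢j (sym j≡i))
  ... | no  _   | no  _   = r-sym i j
  adj-irrefl′ : ∀ i → (if ⌊ i ≟ i ⌋ then false else r i i) ≡ false
  adj-irrefl′ i with i ≟ i
  ... | yes _   = refl
  ... | no  i≢i = ⊥-elim (i≢i refl)

adj-fromSymmetric-false : ∀ {n} r r-sym {u w : Fin n} → r u w ≡ false → adj (fromSymmetric r r-sym) u w ≡ false
adj-fromSymmetric-false r r-sym {u} {w} ruw with ⌊ u ≟ w ⌋
... | true  = refl
... | false = ruw

fin-≤1-irrelevant : ∀ {r} → r ≤ 1 → (z z′ : Fin r) → z ≡ z′
fin-≤1-irrelevant {suc zero}    _         Fin.zero Fin.zero = refl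
fin-≤1-irrelevant {suc (suc _)} (s≤s ()) _        _

fin-≤1-size : ∀ {r} → r ≤ 1 → Fin r → r ≡ 1
fin-≤1-size {suc zero}    _        _ = refl
fin-≤1-size {suc (suc _)} (s≤s ()) _

+-suc-∸ : ∀ {x y n} → x + suc y ≡ n → y ≡ n ∸ suc x
+-suc-∸ {x} {y} eq = trans (sym (m+n∸m≡n (suc x) y)) (cong (_∸ suc x) (trans (sym (+-suc x y)) eq))

xor-cancelˡ : ∀ c b → c xor (c xor b) ≡ b
xor-cancelˡ c b = trans (sym (xor-assoc c c b)) (cong (_xor b) (xor-same c))

same-or-flipped : ∀ {A : Set} (f : Bool → A) a b → f b ≡ f a ⊎ f b ≡ f (not a)
same-or-flipped f false false = inj₁ refl
same-or-flipped f false true  = inj₂ refl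
same-or-flipped f true  false = inj₂ refl
same-or-flipped f true  true  = inj₁ refl

⌊≟⌋-≢ : ∀ {x y : ℕ} → x ≢ y → ⌊ x ℕ.≟ y ⌋ ≡ false
⌊≟⌋-≢ {x} {y} x≢y with x ℕ.≟ y
... | yes x≡y = ⊥-elim (x≢y x≡y)
... | no  _   = refl

⌊≟⌋-injective : ∀ {n} (f : Fin n → ℕ) → (∀ {i j} → f i ≡ f j → i ≡ j) → ∀ i j → ⌊ f i ℕ.≟ f j ⌋ ≡ ⌊ i ≟ j ⌋
⌊≟⌋-injective f f-inj i j with i ≟ j
... | no  i≢j  = ⌊≟⌋-≢ (i≢j ∘ f-inj)
... | yes refl with f i ℕ.≟ f i
...   | yes _   = refl
...   | no  f≢f = ⊥-elim (f≢f refl)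

≡ᵇ-refl : ∀ n → (n ≡ᵇ n) ≡ true
≡ᵇ-refl zero    = refl
≡ᵇ-refl (suc n) = ≡ᵇ-refl n

≢⇒≡ᵇ-false : ∀ {m n} → m ≢ n → (m ≡ᵇ n) ≡ false
≢⇒≡ᵇ-false {m} {n} m≢n with m ≡ᵇ n in eq
... | true  = ⊥-elim (m≢n (≡ᵇ⇒≡ m n (subst T (sym eq) tt)))
... | false = refl

-- The adjacency pattern between the two sides

count< : ℕ → (ℕ → Bool) → ℕ
count< n p = count {n} (p ∘ toℕ)

count<-≢ : ∀ c → count< (suc c) (λ j → not (j ≡ᵇ c)) ≡ c
count<-≢ zero    = refl
count<-≢ (suc c) = cong suc (count<-≢ c)

-- position i j says where j lies relative to i; above and below mean at distance at least two.
data Position : Set where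
  same next prev above below : Position

position : ℕ → ℕ → Position
position zero    zero          = same
position zero    (suc zero)    = next
position zero    (suc (suc _)) = above
position (suc i) zero          = below-by i
  where
  below-by : ℕ → Position
  below-by zero    = prev
  below-by (suc _) = below
position (suc i) (suc j)       = position i j

mirror : Position → Position
mirror same  = same
mirror next  = prev
mirror prev  = next
mirror above = below
mirror below = above

position-mirror : ∀ i j → position j i ≡ mirror (position i j)
position-mirror zero          zero          = refl
position-mirror zero          (suc zero)    = refl
position-mirror zero          (suc (suc _)) = refl
position-mirror (suc zero)    zero          = refl
position-mirror (suc (suc _)) zero          = refl
position-mirror (suc i)       (suc j)       = position-mirror i j

position-self : ∀ i → position i i ≡ same
position-self zero    = refl
position-self (suc i) = position-self i

position-same⇒≡ : ∀ i j → position i j ≡ same → i ≡ j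
position-same⇒≡ zero          zero          _  = refl
position-same⇒≡ zero          (suc zero)    ()
position-same⇒≡ zero          (suc (suc _)) ()
position-same⇒≡ (suc zero)    zero          ()
position-same⇒≡ (suc (suc _)) zero          ()
position-same⇒≡ (suc i)       (suc j)       eq = cong suc (position-same⇒≡ i j eq)

before : (Position → Bool) → ℕ → ℕ
before h zero    = 0
before h (suc _) = bit (h prev)

after : (Position → Bool) → ℕ → ℕ
after h zero    = 0
after h (suc t) = bit (h next) + (if h above then t else 0)

count<-position : (h : Position → Bool) → h below ≡ false → ∀ i t →
                  count< (i + suc t) (h ∘ position i) ≡ before h i + (bit (h same) + after h t)
count<-position h h-below zero t = cong (bit (h same) +_) (right t)
  where
  right : ∀ t → count< t (λ j → h (position 0 (suc j))) ≡ after h t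
  right zero    = refl
  right (suc t) = cong (bit (h next) +_) (count-const t (h above))
count<-position h h-below (suc i) t =
  trans (cong (bit (h (position (suc i) 0)) +_) (count<-position h h-below i t)) (left i)
  where
  left : ∀ i → bit (h (position (suc i) 0)) + (before h i + (bit (h same) + after h t))
             ≡ bit (h prev) + (bit (h same) + after h t)
  left zero    = refl
  left (suc i) = cong (λ b → bit b + (bit (h prev) + (bit (h same) + after h t))) h-below

rule : Bool → Bool → Position → Bool
rule false false same  = true
rule false false prev  = true
rule false false above = true
rule false false _     = false
rule true  true  same  = true
rule true  true  next  = true
rule true  true  above = true
rule true  true  _     = false
rule _     _     next  = true
rule _     _     above = true
rule _     _     _     = false

rule-mirror : ∀ a b p → p ≢ same → rule a b (mirror p) ≡ not (rule b a p)
rule-mirror false false same  p≢same = ⊥-elim (p≢same refl)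
rule-mirror false false next  _ = refl
rule-mirror false false prev  _ = refl
rule-mirror false false above _ = refl
rule-mirror false false below _ = refl
rule-mirror false true  same  p≢same = ⊥-elim (p≢same refl)
rule-mirror false true  next  _ = refl
rule-mirror false true  prev  _ = refl
rule-mirror false true  above _ = refl
rule-mirror false true  below _ = refl
rule-mirror true  false same  p≢same = ⊥-elim (p≢same refl)
rule-mirror true  false next  _ = refl
rule-mirror true  false prev  _ = refl
rule-mirror true  false above _ = refl
rule-mirror true  false below _ = refl
rule-mirror true  true  same  p≢same = ⊥-elim (p≢same refl)
rule-mirror true  true  next  _ = refl
rule-mirror true  true  prev  _ = refl
rule-mirror true  true  above _ = refl
rule-mirror true  true  below _ = refl

rule-same : ∀ a b → rule a b same ≡ not (a xor b)
rule-same false false = refl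
rule-same false true  = refl
rule-same true  false = refl
rule-same true  true  = refl

module Adjacency (k : ℕ) where

  m last : ℕ
  m    = 3 + k
  last = 2 + k

  corner : ℕ → ℕ → Bool
  corner zero    j       = j ≡ᵇ last
  corner (suc i) zero    = suc i ≡ᵇ last
  corner (suc i) (suc j) = false

  corner-sym : ∀ i j → corner i j ≡ corner j i
  corner-sym zero    zero    = refl
  corner-sym zero    (suc _) = refl
  corner-sym (suc _) zero    = refl
  corner-sym (suc _) (suc _) = refl

  corner-self : ∀ i → corner i i ≡ false
  corner-self zero    = refl
  corner-self (suc i) = refl

  -- Flipping the corner entries (0, m − 1) and (m − 1, 0) of the true/true block is what
  -- gives the twins in rows 0 and m − 1 equal degree.
  cross : Bool → Bool → ℕ → ℕ → Bool
  cross a b i j = (a ∧ b ∧ corner i j) xor rule a b (position i j)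

  cross-antisym : ∀ a b i j → i ≢ j → cross a b i j ≡ not (cross b a j i)
  cross-antisym a b i j i≢j = begin
    X xor R                                   ≡⟨ cong (X xor_) (not-involutive R) ⟨
    X xor not (not R)                         ≡⟨ not-distribʳ-xor X (not R) ⟨
    not (X xor not R)                         ≡⟨ cong₂ (λ x y → not (x xor y)) (swap-labels a b)
                                                   (rule-mirror b a (position i j) (i≢j ∘ position-same⇒≡ i j)) ⟨
    not ((b ∧ a ∧ corner j i) xor rule b a (mirror (position i j)))
                                              ≡⟨ cong (λ p → not ((b ∧ a ∧ corner j i) xor rule b a p)) (position-mirror i j) ⟨
    not (cross b a j i) ∎
    where
    open ≡-Reasoning
    X = a ∧ b ∧ corner i j
    R = rule a b (position i j)
    swap-labels : ∀ a b → b ∧ a ∧ corner j i ≡ a ∧ b ∧ corner i j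
    swap-labels false false = refl
    swap-labels false true  = refl
    swap-labels true  false = refl
    swap-labels true  true  = corner-sym j i

  cross-self : ∀ a b i → cross a b i i ≡ not (a xor b)
  cross-self a b i rewrite corner-self i | position-self i | ∧-zeroʳ b | ∧-zeroʳ a = rule-same a b

  rowDegree : ℕ → ℕ → ℕ
  rowDegree zero    t       = t + t
  rowDegree (suc i) zero    = 2
  rowDegree (suc i) (suc s) = suc (suc s + suc s)

  rowSum : Bool → ℕ → ℕ
  rowSum a i = count< m (cross a false i) + count< m (cross a true i)

  private
    rows : ∀ a i t → i + suc t ≡ m →
           count< (i + suc t) (cross a false i) + count< (i + suc t) (cross a true i) ≡ rowDegree i t
    rows false i t eq = trans
      (cong₂ _+_ (count<-position (rule false false) refl i t) (count<-position (rule false true) refl i t))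
      (closed i t eq)
      where
      closed : ∀ i t → i + suc t ≡ m →
        before (rule false false) i + (1 + after (rule false false) t)
          + (before (rule false true) i + (0 + after (rule false true) t)) ≡ rowDegree i t
      closed zero    zero    ()
      closed zero    (suc s) _ = refl
      closed (suc i) zero    _ = refl
      closed (suc i) (suc s) _ = refl
    rows true zero zero ()
    rows true zero (suc s) eq with refl ← suc-injective (suc-injective eq) =
      cong₂ _+_ (count<-position (rule true false) refl 0 last)
                (trans (count-cong {m} (λ j → flipped (toℕ j))) (count<-≢ last))
      where
      flipped : ∀ j → corner 0 j xor rule true true (position 0 j) ≡ not (j ≡ᵇ last)
      flipped zero          = refl
      flipped (suc zero)    = xor-comm (suc zero ≡ᵇ last) true
      flipped (suc (suc j)) = xor-comm (suc (suc j) ≡ᵇ last) true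
    rows true (suc i) zero eq with refl ← suc-injective (trans (+-comm 1 i) (suc-injective eq)) =
      cong₂ _+_ (count<-position (rule true false) refl last 0)
                (cong₂ _+_ (cong (λ b → bit (b xor false)) (≡ᵇ-refl last))
                           (count<-position (rule true true) refl (suc k) 0))
    rows true (suc i) (suc s) eq = trans
      (cong (count< (suc i + suc (suc s)) (cross true false (suc i)) +_) (count-cong {suc i + suc (suc s)} unflipped))
      (trans (cong₂ _+_ (count<-position (rule true false) refl (suc i) (suc s))
                        (count<-position (rule true true) refl (suc i) (suc s)))
             (+-suc (suc s) (suc s)))
      where
      not-last : suc i ≢ last
      not-last i≡last with () ← +-cancelˡ-≡ (suc i) (suc (suc s)) 1
                                  (trans eq (sym (trans (+-comm (suc i) 1) (cong suc i≡last))))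
      unflipped : ∀ j → cross true true (suc i) (toℕ j) ≡ rule true true (position (suc i) (toℕ j))
      unflipped Fin.zero    = cong (_xor rule true true (position (suc i) 0)) (≢⇒≡ᵇ-false not-last)
      unflipped (Fin.suc j) = refl

  rowSum-≡ : ∀ a i t → i + suc t ≡ m → rowSum a i ≡ rowDegree i t
  rowSum-≡ a i t eq =
    trans (cong (λ n → count< n (cross a false i) + count< n (cross a true i)) (sym eq)) (rows a i t eq)

  private
    double : ∀ a → 2 * a ≡ a + a
    double a = cong (a +_) (+-identityʳ a)

    even≢odd′ : ∀ a b → a + a ≢ suc (b + b)
    even≢odd′ a b eq = even≢odd a b (trans (double a) (trans eq (cong suc (sym (double b)))))

    double-injective : ∀ {a b} → a + a ≡ b + b → a ≡ b
    double-injective {a} {b} eq = *-cancelˡ-≡ a b 2 (trans (double a) (trans eq (sym (double b))))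

    first≢last : ∀ t → suc t ≡ m → t + t ≢ 2
    first≢last t eq rewrite suc-injective eq = m+1+n≢0 k ∘ suc-injective ∘ suc-injective

    last≢middle : ∀ s → 2 ≢ suc (suc s + suc s)
    last≢middle s = m+1+n≢0 s ∘ sym ∘ suc-injective ∘ suc-injective

  rowDegree-injective : ∀ i t i′ t′ → i + suc t ≡ m → i′ + suc t′ ≡ m →
                        rowDegree i t ≡ rowDegree i′ t′ → i ≡ i′
  rowDegree-injective zero    t       zero     t′       _  _   _  = refl
  rowDegree-injective zero    t       (suc i′) zero     eq _   d≡ = ⊥-elim (first≢last t eq d≡)
  rowDegree-injective zero    t       (suc i′) (suc s′) _  _   d≡ = ⊥-elim (even≢odd′ t (suc s′) d≡)
  rowDegree-injective (suc i) zero    zero     t′       _  eq′ d≡ = ⊥-elim (first≢last t′ eq′ (sym d≡))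
  rowDegree-injective (suc i) zero    (suc i′) zero     eq eq′ _  = +-cancelʳ-≡ 1 (suc i) (suc i′) (trans eq (sym eq′))
  rowDegree-injective (suc i) zero    (suc i′) (suc s′) _  _   d≡ = ⊥-elim (last≢middle s′ d≡)
  rowDegree-injective (suc i) (suc s) zero     t′       _  _   d≡ = ⊥-elim (even≢odd′ t′ (suc s) (sym d≡))
  rowDegree-injective (suc i) (suc s) (suc i′) zero     _  _   d≡ = ⊥-elim (last≢middle s (sym d≡))
  rowDegree-injective (suc i) (suc s) (suc i′) (suc s′) eq eq′ d≡
    with refl ← double-injective {suc s} {suc s′} (suc-injective d≡) =
    +-cancelʳ-≡ (suc (suc s)) (suc i) (suc i′) (trans eq (sym eq′))

  rowDegree-bound : ∀ i t → i + suc t ≡ m → 2 + rowDegree i t ≤ m + m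
  rowDegree-bound zero    t       eq = ≤-reflexive (trans (cong suc (sym (+-suc t t))) (cong₂ _+_ eq eq))
  rowDegree-bound (suc i) zero    _  = +-mono-≤ {2} {m} {2} {m} (s≤s (s≤s z≤n)) (s≤s (s≤s z≤n))
  rowDegree-bound (suc i) (suc s) eq = ≤-trans (n≤1+n _)
    (≤-trans (≤-reflexive (sym (arith s))) (+-mono-≤ middle≤m middle≤m))
    where
    middle≤m : 3 + s ≤ m
    middle≤m = subst (3 + s ≤_) eq (s≤s (m≤n+m (suc (suc s)) i))
    arith : ∀ s → (3 + s) + (3 + s) ≡ 1 + (2 + suc (suc s + suc s))
    arith = solve 1 (λ s → (con 3 :+ s) :+ (con 3 :+ s) := con 1 :+ (con 2 :+ (con 1 :+ ((con 1 :+ s) :+ (con 1 :+ s))))) refl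
      where open +-*-Solver

  position-prev : ∀ i → position (suc i) i ≡ prev
  position-prev zero    = refl
  position-prev (suc i) = position-prev i

  position-next : ∀ i → position i (suc i) ≡ next
  position-next zero    = refl
  position-next (suc i) = position-next i

  corner-prev : ∀ i → corner (suc i) i ≡ false
  corner-prev zero    = refl
  corner-prev (suc i) = refl

  hitsInColumn : Bool → ℕ → ℕ → ℕ
  hitsInColumn a i p = bit (cross a false i p) + bit (cross a true i p)

  hitsInRow : Bool → ℕ → ℕ → ℕ
  hitsInRow b p j = bit (cross false b p j) + bit (cross true b p j)

  distinguishing-column : ∀ i → i < m → ∃[ p ] p < m × hitsInColumn false i p ≢ hitsInColumn true i p
  distinguishing-column zero    _   = 1 , s≤s (s≤s z≤n) , λ ()
  distinguishing-column (suc i) i<m = i , <-trans (n<1+n i) i<m , differs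
    where
    differs : hitsInColumn false (suc i) i ≢ hitsInColumn true (suc i) i
    differs rewrite position-prev i | corner-prev i = λ ()

  distinguishing-row : ∀ j → j < m → ∃[ p ] p < m × hitsInRow false p j ≢ hitsInRow true p j
  distinguishing-row j j<m with m≤n⇒m<n∨m≡n (≤-pred j<m)
  ... | inj₁ j<last = suc j , s≤s j<last , differs
    where
    differs : hitsInRow false (suc j) j ≢ hitsInRow true (suc j) j
    differs rewrite position-prev j | corner-prev j = λ ()
  ... | inj₂ refl = suc k , s≤s (s≤s (n≤1+n k)) , differs
    where
    differs : hitsInRow false (suc k) last ≢ hitsInRow true (suc k) last
    differs rewrite position-next (suc k) = λ ()

-- The graph

module Construction (k r : ℕ) (r≤1 : r ≤ 1) where

  open Adjacency k

  data Vertex : Set where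
    left right : Bool → Fin m → Vertex
    apex       : Fin r → Vertex

  N : ℕ
  N = m + (m + (m + (m + r)))

  decode₄ : Fin (m + r) → Vertex
  decode₄ = block (right true) apex

  decode₃ : Fin (m + (m + r)) → Vertex
  decode₃ = block (right false) decode₄

  decode₂ : Fin (m + (m + (m + r))) → Vertex
  decode₂ = block (left true) decode₃

  decode : Fin N → Vertex
  decode = block (left false) decode₂

  encode : Vertex → Fin N
  encode (left false i)  = i ↑ˡ _
  encode (left true i)   = m ↑ʳ (i ↑ˡ _)
  encode (right false j) = m ↑ʳ (m ↑ʳ (j ↑ˡ _))
  encode (right true j)  = m ↑ʳ (m ↑ʳ (m ↑ʳ (j ↑ˡ _)))
  encode (apex z)        = m ↑ʳ (m ↑ʳ (m ↑ʳ (m ↑ʳ z)))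

  decode-encode : ∀ x → decode (encode x) ≡ x
  decode-encode (left false i)  = block-↑ˡ (left false) decode₂ i
  decode-encode (left true i)   = trans (block-↑ʳ (left false) decode₂ _) (block-↑ˡ (left true) decode₃ i)
  decode-encode (right false j) = trans (block-↑ʳ (left false) decode₂ _)
    (trans (block-↑ʳ (left true) decode₃ _) (block-↑ˡ (right false) decode₄ j))
  decode-encode (right true j)  = trans (block-↑ʳ (left false) decode₂ _)
    (trans (block-↑ʳ (left true) decode₃ _) (trans (block-↑ʳ (right false) decode₄ _) (block-↑ˡ (right true) apex j)))
  decode-encode (apex z)        = trans (block-↑ʳ (left false) decode₂ _)
    (trans (block-↑ʳ (left true) decode₃ _) (trans (block-↑ʳ (right false) decode₄ _) (block-↑ʳ (right true) apex z)))

  encode-decode : ∀ u → encode (decode u) ≡ u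
  encode-decode =
    block-unique (left false) decode₂ encode id (λ _ → refl)
      (block-unique (left true) decode₃ encode (m ↑ʳ_) (λ _ → refl)
        (block-unique (right false) decode₄ encode (λ j → m ↑ʳ (m ↑ʳ j)) (λ _ → refl)
          (block-unique (right true) apex encode (λ j → m ↑ʳ (m ↑ʳ (m ↑ʳ j))) (λ _ → refl) (λ _ → refl))))

  decode-injective : ∀ {u v} → decode u ≡ decode v → u ≡ v
  decode-injective {u} {v} eq = trans (sym (encode-decode u)) (trans (cong encode eq) (encode-decode v))

  count-decode : (q : Vertex → Bool) → count (q ∘ decode) ≡
    count (q ∘ left false) + (count (q ∘ left true) + (count (q ∘ right false) + (count (q ∘ right true) + count (q ∘ apex))))
  count-decode q =
    trans (count-block (left false) decode₂ q) (cong (count (q ∘ left false) +_)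
    (trans (count-block (left true) decode₃ q) (cong (count (q ∘ left true) +_)
    (trans (count-block (right false) decode₄ q) (cong (count (q ∘ right false) +_)
    (count-block (right true) apex q))))))

  edge : Vertex → Vertex → Bool
  edge (left a i)  (right b j) = cross a b (toℕ i) (toℕ j)
  edge (right b j) (left a i)  = cross a b (toℕ i) (toℕ j)
  edge (right _ _) (right _ _) = true
  edge (right _ _) (apex _)    = true
  edge (apex _)    (right _ _) = true
  edge _           _           = false

  edge-sym : ∀ x y → edge x y ≡ edge y x
  edge-sym (left _ _)  (left _ _)  = refl
  edge-sym (left _ _)  (right _ _) = refl
  edge-sym (left _ _)  (apex _)    = refl
  edge-sym (right _ _) (left _ _)  = refl
  edge-sym (right _ _) (right _ _) = refl
  edge-sym (right _ _) (apex _)    = refl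
  edge-sym (apex _)    (left _ _)  = refl
  edge-sym (apex _)    (right _ _) = refl
  edge-sym (apex _)    (apex _)    = refl

  edgeAt : Fin N → Fin N → Bool
  edgeAt u w = edge (decode u) (decode w)

  G : Graph N
  G = fromSymmetric edgeAt (λ u w → edge-sym (decode u) (decode w))

  adj-G-≢ : ∀ u w → u ≢ w → adj G u w ≡ edgeAt u w
  adj-G-≢ u w = if-≢ {i = u} {j = w} (edgeAt u w)

  adj-G-false : ∀ u w → edgeAt u w ≡ false → adj G u w ≡ false
  adj-G-false u w = adj-fromSymmetric-false edgeAt (λ u w → edge-sym (decode u) (decode w)) {u} {w}

  independentSide : Vertex → Bool
  independentSide (right _ _) = false
  independentSide _           = true

  edge-independent : ∀ x y → independentSide x ≡ true → independentSide y ≡ true → edge x y ≡ false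
  edge-independent (left _ _)  (left _ _)  _  _  = refl
  edge-independent (left _ _)  (apex _)    _  _  = refl
  edge-independent (apex _)    (left _ _)  _  _  = refl
  edge-independent (apex _)    (apex _)    _  _  = refl
  edge-independent (right _ _) _           () _
  edge-independent (left _ _)  (right _ _) _  ()
  edge-independent (apex _)    (right _ _) _  ()

  edge-clique : ∀ x y → independentSide x ≡ false → independentSide y ≡ false → edge x y ≡ true
  edge-clique (right _ _) (right _ _) _  _  = refl
  edge-clique (left _ _)  _           () _
  edge-clique (apex _)    _           () _
  edge-clique (right _ _) (left _ _)  _  ()
  edge-clique (right _ _) (apex _)    _  ()

  G-split : IsSplit G
  G-split = independentSide ∘ decode
          , (λ u v p q → adj-G-false u v (edge-independent (decode u) (decode v) p q))
          , (λ u v p q u≢v → trans (adj-G-≢ u v u≢v) (edge-clique (decode u) (decode v) p q))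

  swapSides : Vertex → Vertex
  swapSides (left a i)  = right a i
  swapSides (right b j) = left b j
  swapSides (apex z)    = apex z

  flipAcross : Vertex → Vertex → Vertex
  flipAcross (left _ i)  (right b j) = right (⌊ j ≟ i ⌋ xor b) j
  flipAcross (right _ j) (left a i)  = left (⌊ i ≟ j ⌋ xor a) i
  flipAcross _           w           = w

  swapSides-involutive : ∀ x → swapSides (swapSides x) ≡ x
  swapSides-involutive (left _ _)  = refl
  swapSides-involutive (right _ _) = refl
  swapSides-involutive (apex _)    = refl

  flipAcross-involutive : ∀ v w → flipAcross v (flipAcross v w) ≡ w
  flipAcross-involutive (left _ i)  (left _ _)  = refl
  flipAcross-involutive (left _ i)  (right b j) = cong (λ b → right b j) (xor-cancelˡ ⌊ j ≟ i ⌋ b)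
  flipAcross-involutive (left _ i)  (apex _)    = refl
  flipAcross-involutive (right _ j) (left a i)  = cong (λ a → left a i) (xor-cancelˡ ⌊ i ≟ j ⌋ a)
  flipAcross-involutive (right _ j) (right _ _) = refl
  flipAcross-involutive (right _ j) (apex _)    = refl
  flipAcross-involutive (apex _)    _           = refl

  flipAcross-self : ∀ v → flipAcross v v ≡ v
  flipAcross-self (left _ _)  = refl
  flipAcross-self (right _ _) = refl
  flipAcross-self (apex _)    = refl

  edge-swap-flipAcross : ∀ v w → v ≢ w → edge (swapSides v) (swapSides (flipAcross v w)) ≡ not (edge v w)
  edge-swap-flipAcross (left _ _)  (left _ _)  _ = refl
  edge-swap-flipAcross (left a i)  (right b j) _ with j ≟ i
  ... | yes refl = begin
    cross (not b) a (toℕ i) (toℕ i) ≡⟨ cross-self (not b) a (toℕ i) ⟩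
    not (not b xor a)               ≡⟨ cong not (not-distribˡ-xor b a) ⟨
    not (not (b xor a))             ≡⟨ cong (λ x → not (not x)) (xor-comm b a) ⟩
    not (not (a xor b))             ≡⟨ cong not (cross-self a b (toℕ i)) ⟨
    not (cross a b (toℕ i) (toℕ i)) ∎
    where open ≡-Reasoning
  ... | no j≢i = cross-antisym b a (toℕ j) (toℕ i) (j≢i ∘ toℕ-injective)
  edge-swap-flipAcross (left _ _)  (apex _)    _ = refl
  edge-swap-flipAcross (right b j) (left a i)  _ with i ≟ j
  ... | yes refl = begin
    cross b (not a) (toℕ i) (toℕ i) ≡⟨ cross-self b (not a) (toℕ i) ⟩
    not (b xor not a)               ≡⟨ cong not (not-distribʳ-xor b a) ⟨
    not (not (b xor a))             ≡⟨ cong (λ x → not (not x)) (xor-comm b a) ⟩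
    not (not (a xor b))             ≡⟨ cong not (cross-self a b (toℕ i)) ⟨
    not (cross a b (toℕ i) (toℕ i)) ∎
    where open ≡-Reasoning
  ... | no i≢j = cross-antisym b a (toℕ j) (toℕ i) (i≢j ∘ sym ∘ toℕ-injective)
  edge-swap-flipAcross (right _ _) (right _ _) _ = refl
  edge-swap-flipAcross (right _ _) (apex _)    _ = refl
  edge-swap-flipAcross (apex _)    (left _ _)  _ = refl
  edge-swap-flipAcross (apex _)    (right _ _) _ = refl
  edge-swap-flipAcross (apex z)    (apex z′)   v≢w = ⊥-elim (v≢w (cong apex (fin-≤1-irrelevant r≤1 z z′)))

  relabel : (σ ρ : Vertex → Vertex) → (∀ x → ρ (σ x) ≡ x) → (∀ x → σ (ρ x) ≡ x) → Permutation′ N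
  relabel σ ρ ρσ σρ = permutation (encode ∘ σ ∘ decode) (encode ∘ ρ ∘ decode) (inverse σ ρ σρ) (inverse ρ σ ρσ)
    where
    inverse : ∀ f g → (∀ x → f (g x) ≡ x) → ∀ u → encode (f (decode (encode (g (decode u))))) ≡ u
    inverse f g fg u = trans (cong (encode ∘ f) (decode-encode _)) (trans (cong encode (fg _)) (encode-decode u))

  partner : Fin N → Fin N
  partner u = encode (swapSides (decode u))

  complementMap : Fin N → Permutation′ N
  complementMap u = relabel (swapSides ∘ flipAcross v) (flipAcross v ∘ swapSides)
    (λ x → trans (cong (flipAcross v) (swapSides-involutive _)) (flipAcross-involutive v x))
    (λ y → trans (cong swapSides (flipAcross-involutive v _)) (swapSides-involutive y))
    where v = decode u

  adj-complement-partner : ∀ u w → adj (complement G) (partner u) (complementMap u ⟨$⟩ʳ w) ≡ adj G u w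
  adj-complement-partner u w with u ≟ w
  ... | yes refl = trans (cong (adj (complement G) (partner u)) (cong (encode ∘ swapSides) (flipAcross-self (decode u))))
                         (adj-irrefl (complement G) (partner u))
  ... | no u≢w = begin
    adj (complement G) (partner u) (π ⟨$⟩ʳ w)     ≡⟨ if-≢ {i = partner u} (not (adj G (partner u) (π ⟨$⟩ʳ w))) partner≢ ⟩
    not (adj G (partner u) (π ⟨$⟩ʳ w))           ≡⟨ cong not (adj-G-≢ (partner u) (π ⟨$⟩ʳ w) partner≢) ⟩
    not (edgeAt (partner u) (π ⟨$⟩ʳ w))          ≡⟨ cong₂ (λ x y → not (edge x y)) (decode-encode (swapSides v))
                                                           (decode-encode (swapSides (flipAcross v (decode w)))) ⟩
    not (edge (swapSides v) (swapSides (flipAcross v (decode w))))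
                                                  ≡⟨ cong not (edge-swap-flipAcross v (decode w) (u≢w ∘ decode-injective)) ⟩
    not (not (edgeAt u w))                        ≡⟨ not-involutive _ ⟩
    edgeAt u w ∎
    where
    open ≡-Reasoning
    v = decode u
    π = complementMap u
    partner≢ : partner u ≢ π ⟨$⟩ʳ w
    partner≢ eq = u≢w (trans (sym (inverseˡ π))
      (trans (cong (π ⟨$⟩ˡ_) (trans (cong (encode ∘ swapSides) (flipAcross-self v)) eq)) (inverseˡ π)))

  degree-partner : ∀ u → degree (complement G) (partner u) ≡ degree G u
  degree-partner u = degree-preserved G (complement G) (complementMap u) {u} {partner u} (adj-complement-partner u)

  leftDegree : Fin m → ℕ
  leftDegree i = rowDegree (toℕ i) (m ∸ suc (toℕ i))

  degreeOf : Vertex → ℕ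
  degreeOf (left _ i)  = leftDegree i
  degreeOf (right _ j) = N ∸ suc (leftDegree j)
  degreeOf (apex _)    = m + m

  row-split : ∀ (i : Fin m) → toℕ i + suc (m ∸ suc (toℕ i)) ≡ m
  row-split i = trans (+-suc (toℕ i) _) (m+[n∸m]≡n (toℕ<n i))

  leftDegree-bound : ∀ i → 2 + leftDegree i ≤ m + m
  leftDegree-bound i = rowDegree-bound (toℕ i) _ (row-split i)

  leftDegree-injective : ∀ {i j} → leftDegree i ≡ leftDegree j → i ≡ j
  leftDegree-injective {i} {j} eq = toℕ-injective (rowDegree-injective _ _ _ _ (row-split i) (row-split j) eq)

  m+m≤N : m + m ≤ N
  m+m≤N = +-monoʳ-≤ m (m≤m+n m _)

  leftDegree<N : ∀ i → leftDegree i < N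
  leftDegree<N i = ≤-trans (n≤1+n _) (≤-trans (leftDegree-bound i) m+m≤N)

  degreeOf-pair : ∀ x → degreeOf x + suc (degreeOf (swapSides x)) ≡ N
  degreeOf-pair (left _ i)  = trans (+-suc (leftDegree i) _) (m+[n∸m]≡n (leftDegree<N i))
  degreeOf-pair (right _ j) = m∸n+n≡m (leftDegree<N j)
  degreeOf-pair (apex z) rewrite fin-≤1-size r≤1 z = arith m
    where
    arith : ∀ m → (m + m) + suc (m + m) ≡ m + (m + (m + (m + 1)))
    arith = solve 1 (λ m → (m :+ m) :+ (con 1 :+ (m :+ m)) := m :+ (m :+ (m :+ (m :+ con 1)))) refl
      where open +-*-Solver

  degreeOf-flipAcross : ∀ v w → degreeOf (flipAcross v w) ≡ degreeOf w
  degreeOf-flipAcross (left _ _)  (left _ _)  = refl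
  degreeOf-flipAcross (left _ _)  (right _ _) = refl
  degreeOf-flipAcross (left _ _)  (apex _)    = refl
  degreeOf-flipAcross (right _ _) (left _ _)  = refl
  degreeOf-flipAcross (right _ _) (right _ _) = refl
  degreeOf-flipAcross (right _ _) (apex _)    = refl
  degreeOf-flipAcross (apex _)    _           = refl

  count-edge : ∀ x → independentSide x ≡ true → count (edge x ∘ decode) ≡ degreeOf x
  count-edge (left a i) _ = begin
    count (edge (left a i) ∘ decode)                                   ≡⟨ count-decode (edge (left a i)) ⟩
    none m + (none m + (R₁ + (R₂ + none r)))
                                                                       ≡⟨ cong₂ (λ x y → x + (x + (R₁ + (R₂ + y))))
                                                                                (count-false m) (count-false r) ⟩
    R₁ + (R₂ + 0)                                                      ≡⟨ cong (R₁ +_) (+-identityʳ R₂) ⟩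
    rowSum a i′                                                        ≡⟨ rowSum-≡ a i′ _ (row-split i) ⟩
    leftDegree i ∎
    where
    open ≡-Reasoning
    i′ = toℕ i
    R₁ = count< m (cross a false i′)
    R₂ = count< m (cross a true i′)
    none : ∀ n → ℕ
    none n = count {n} (λ _ → false)
  count-edge (apex z)   _ = begin
    count (edge (apex z) ∘ decode)                                   ≡⟨ count-decode (edge (apex z)) ⟩
    none m + (none m + (all m + (all m + none r)))                   ≡⟨ cong₂ (λ x y → x + (x + (y + (y + none r))))
                                                                              (count-false m) (count-true m) ⟩
    m + (m + none r)                                                 ≡⟨ cong (λ x → m + (m + x)) (count-false r) ⟩
    m + (m + 0)                                                      ≡⟨ cong (m +_) (+-identityʳ m) ⟩
    m + m ∎
    where
    open ≡-Reasoning
    none all : ∀ n → ℕ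
    none n = count {n} (λ _ → false)
    all  n = count {n} (λ _ → true)

  adj-G-loopfree : ∀ u → edgeAt u u ≡ false → ∀ w → adj G u w ≡ edgeAt u w
  adj-G-loopfree u loop w with u ≟ w
  ... | yes refl = sym loop
  ... | no  _    = refl

  degree-independentSide : ∀ u → independentSide (decode u) ≡ true → degree G u ≡ degreeOf (decode u)
  degree-independentSide u p = trans (degree-count G u)
    (trans (count-cong (adj-G-loopfree u (edge-independent _ _ p p))) (count-edge (decode u) p))

  degree≡degreeOf : ∀ u → degree G u ≡ degreeOf (decode u)
  degree≡degreeOf u = by-class (decode u) refl
    where
    by-class : ∀ x → decode u ≡ x → degree G u ≡ degreeOf (decode u)
    by-class (left _ _)  eq = degree-independentSide u (cong independentSide eq)
    by-class (apex _)    eq = degree-independentSide u (cong independentSide eq)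
    by-class (right b j) eq = begin
      degree G u                          ≡⟨ +-suc-∸ (degree-complement G u) ⟩
      N ∸ suc (degree (complement G) u)   ≡⟨ cong (λ d → N ∸ suc d) complement-degree ⟩
      N ∸ suc (leftDegree j)              ≡⟨ cong degreeOf eq ⟨
      degreeOf (decode u) ∎
      where
      open ≡-Reasoning
      u′ = encode (left b j)
      u≡partner : partner u′ ≡ u
      u≡partner = trans (cong (encode ∘ swapSides) (decode-encode (left b j)))
                        (trans (cong encode (sym eq)) (encode-decode u))
      complement-degree : degree (complement G) u ≡ leftDegree j
      complement-degree = trans (cong (degree (complement G)) (sym u≡partner))
        (trans (degree-partner u′) (trans (degree-independentSide u′ (cong independentSide (decode-encode (left b j))))
                                          (cong degreeOf (decode-encode (left b j)))))

  partner-involutive : ∀ u → partner (partner u) ≡ u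
  partner-involutive u = trans (cong (encode ∘ swapSides) (decode-encode (swapSides (decode u))))
                               (trans (cong encode (swapSides-involutive (decode u))) (encode-decode u))

  type-partner : ∀ u → vertexType (complement G) (partner u) ≡ vertexType G u
  type-partner u =
    vertexType-preserved G (complement G) π {u} {partner u} (adj-complement-partner u) degree-π
    where
    π = complementMap u
    degree-π : ∀ w → degree (complement G) (π ⟨$⟩ʳ w) ≡ degree G w
    degree-π w = +-cancelʳ-≡ (suc D) _ _ (begin
      degree (complement G) (π ⟨$⟩ʳ w) + suc D
        ≡⟨ cong (λ d → degree (complement G) (π ⟨$⟩ʳ w) + suc d)
                (trans (degree≡degreeOf (π ⟨$⟩ʳ w)) (cong degreeOf (decode-encode (swapSides y)))) ⟨
      degree (complement G) (π ⟨$⟩ʳ w) + suc (degree G (π ⟨$⟩ʳ w))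
        ≡⟨ degree-complement G (π ⟨$⟩ʳ w) ⟩
      N ≡⟨ degreeOf-pair y ⟨
      degreeOf y + suc D
        ≡⟨ cong (λ d → d + suc D) (trans (degreeOf-flipAcross (decode u) (decode w)) (sym (degree≡degreeOf w))) ⟩
      degree G w + suc D ∎)
      where
      open ≡-Reasoning
      y = flipAcross (decode u) (decode w)
      D = degreeOf (swapSides y)

  G-sameTypes : SameTypeSets G (complement G)
  G-sameTypes = (λ u → partner u , sym (type-partner u))
              , (λ v → partner v , trans (cong (vertexType (complement G)) (sym (partner-involutive v)))
                                         (type-partner (partner v)))

  rightDegree-injective : ∀ {i j} → N ∸ suc (leftDegree i) ≡ N ∸ suc (leftDegree j) → i ≡ j
  rightDegree-injective {i} {j} eq = leftDegree-injective (suc-injective (∸-cancelˡ-≡ (leftDegree<N i) (leftDegree<N j) eq))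

  leftDegree<apex : ∀ i → leftDegree i < m + m
  leftDegree<apex i = ≤-trans (n≤1+n _) (leftDegree-bound i)

  apex<rightDegree : ∀ j → m + m < N ∸ suc (leftDegree j)
  apex<rightDegree j = ≤-pred (+-cancelˡ-≤ d (2 + (m + m)) (suc R) (begin
    d + (2 + (m + m))   ≡⟨ +-suc d _ ⟩
    suc (d + suc (m + m)) ≡⟨ cong suc (+-suc d (m + m)) ⟩
    (2 + d) + (m + m)   ≤⟨ +-monoˡ-≤ (m + m) (leftDegree-bound j) ⟩
    (m + m) + (m + m)   ≡⟨ +-assoc m m (m + m) ⟩
    m + (m + (m + m))   ≤⟨ +-monoʳ-≤ m (+-monoʳ-≤ m (+-monoʳ-≤ m (m≤m+n m r))) ⟩
    N                   ≡⟨ degreeOf-pair (left false j) ⟨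
    d + suc R ∎))
    where
    open ≤-Reasoning
    d = leftDegree j
    R = N ∸ suc d

  leftDegree<rightDegree : ∀ i j → leftDegree i < N ∸ suc (leftDegree j)
  leftDegree<rightDegree i j = <-trans (leftDegree<apex i) (apex<rightDegree j)

  twin : Vertex → Vertex
  twin (left a i)  = left (not a) i
  twin (right b j) = right (not b) j
  twin (apex z)    = apex z

  degreeOf-classes : ∀ x y → degreeOf x ≡ degreeOf y → y ≡ x ⊎ y ≡ twin x
  degreeOf-classes (left a i)  (left b j)  eq with refl ← leftDegree-injective {i} {j} eq =
    same-or-flipped (λ c → left c i) a b
  degreeOf-classes (right a i) (right b j) eq with refl ← rightDegree-injective {i} {j} eq =
    same-or-flipped (λ c → right c i) a b
  degreeOf-classes (apex z)    (apex z′)   _  = inj₁ (cong apex (fin-≤1-irrelevant r≤1 z′ z))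
  degreeOf-classes (left _ i)  (right _ j) eq = ⊥-elim (<⇒≢ (leftDegree<rightDegree i j) eq)
  degreeOf-classes (right _ i) (left _ j)  eq = ⊥-elim (<⇒≢ (leftDegree<rightDegree j i) (sym eq))
  degreeOf-classes (left _ i)  (apex _)    eq = ⊥-elim (<⇒≢ (leftDegree<apex i) eq)
  degreeOf-classes (apex _)    (left _ j)  eq = ⊥-elim (<⇒≢ (leftDegree<apex j) (sym eq))
  degreeOf-classes (right _ i) (apex _)    eq = ⊥-elim (<⇒≢ (apex<rightDegree i) (sym eq))
  degreeOf-classes (apex _)    (right _ j) eq = ⊥-elim (<⇒≢ (apex<rightDegree j) eq)

  neighboursOfDegree : Vertex → ℕ → ℕ
  neighboursOfDegree x D = count (λ w → edge x (decode w) ∧ ⌊ degreeOf (decode w) ℕ.≟ D ⌋)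

  -- edge is true on the diagonal of the clique side, but G has no loops; the hypothesis on D
  -- makes the diagonal term irrelevant.
  count-neighboursOfDegree : ∀ u D → D ≢ degreeOf (decode u) →
    count (λ w → adj G u w ∧ ⌊ degree G w ℕ.≟ D ⌋) ≡ neighboursOfDegree (decode u) D
  count-neighboursOfDegree u D D≢ = count-cong pointwise
    where
    pointwise : ∀ w → adj G u w ∧ ⌊ degree G w ℕ.≟ D ⌋ ≡ edgeAt u w ∧ ⌊ degreeOf (decode w) ℕ.≟ D ⌋
    pointwise w with u ≟ w
    ... | yes refl = sym (trans (cong (edgeAt u u ∧_) (⌊≟⌋-≢ (D≢ ∘ sym))) (∧-zeroʳ _))
    ... | no  _    = cong (λ d → edgeAt u w ∧ ⌊ d ℕ.≟ D ⌋) (degree≡degreeOf w)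

  neighboursOfDegree-≡ : ∀ {u v} → vertexType G u ≡ vertexType G v → ∀ D → D ≢ degreeOf (decode u) →
    neighboursOfDegree (decode u) D ≡ neighboursOfDegree (decode v) D
  neighboursOfDegree-≡ {u} {v} same-type D D≢ = begin
    neighboursOfDegree (decode u) D                   ≡⟨ count-neighboursOfDegree u D D≢ ⟨
    count (λ w → adj G u w ∧ ⌊ degree G w ℕ.≟ D ⌋)   ≡⟨ vertexType-≡⇒count-≡ G {u} {v} same-type (λ d → ⌊ d ℕ.≟ D ⌋) ⟩
    count (λ w → adj G v w ∧ ⌊ degree G w ℕ.≟ D ⌋)   ≡⟨ count-neighboursOfDegree v D (D≢ ∘ flip trans (sym degrees)) ⟩
    neighboursOfDegree (decode v) D ∎
    where
    open ≡-Reasoning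
    degrees : degreeOf (decode u) ≡ degreeOf (decode v)
    degrees = trans (sym (degree≡degreeOf u)) (trans (vertexType-≡⇒degree-≡ G {u} {v} same-type) (degree≡degreeOf v))

  neighboursOfDegree-left : ∀ a i p →
    neighboursOfDegree (left a i) (degreeOf (right false p)) ≡ hitsInColumn a (toℕ i) (toℕ p)
  neighboursOfDegree-left a i p = begin
    neighboursOfDegree (left a i) D                      ≡⟨ count-decode q ⟩
    none m + (none m + (count (q ∘ right false) + (count (q ∘ right true) + none r)))
                                                         ≡⟨ cong₂ (λ x y → x + (x + y)) (count-false m)
                                                              (cong₂ (λ x y → x + (y + none r)) (column false) (column true)) ⟩
    bit (cross a false i′ p′) + (bit (cross a true i′ p′) + none r)
                                                         ≡⟨ cong (λ x → bit (cross a false i′ p′) + (bit (cross a true i′ p′) + x))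
                                                                 (count-false r) ⟩
    bit (cross a false i′ p′) + (bit (cross a true i′ p′) + 0)
                                                         ≡⟨ cong (bit (cross a false i′ p′) +_) (+-identityʳ _) ⟩
    hitsInColumn a i′ p′ ∎
    where
    open ≡-Reasoning
    D  = degreeOf (right false p)
    i′ = toℕ i
    p′ = toℕ p
    q : Vertex → Bool
    q x = edge (left a i) x ∧ ⌊ degreeOf x ℕ.≟ D ⌋
    none : ∀ n → ℕ
    none n = count {n} (λ _ → false)
    column : ∀ b → count (q ∘ right b) ≡ bit (cross a b i′ p′)
    column b = trans (count-cong (λ j → cong (cross a b i′ (toℕ j) ∧_) (⌊≟⌋-injective _ rightDegree-injective j p)))
                     (count-point (λ j → cross a b i′ (toℕ j)) p)

  neighboursOfDegree-right : ∀ b j p →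
    neighboursOfDegree (right b j) (degreeOf (left false p)) ≡ hitsInRow b (toℕ p) (toℕ j)
  neighboursOfDegree-right b j p = begin
    neighboursOfDegree (right b j) D                     ≡⟨ count-decode q ⟩
    count (q ∘ left false) + (count (q ∘ left true) + (count (q ∘ right false) + (count (q ∘ right true) + count (q ∘ apex))))
                                                         ≡⟨ cong₂ _+_ (row false) (cong₂ _+_ (row true)
                                                              (cong₂ _+_ (far false) (cong₂ _+_ (far true) apex-far))) ⟩
    bit (cross false b p′ j′) + (bit (cross true b p′ j′) + (0 + (0 + 0)))
                                                         ≡⟨ cong (bit (cross false b p′ j′) +_) (+-identityʳ _) ⟩
    hitsInRow b p′ j′ ∎
    where
    open ≡-Reasoning
    D  = degreeOf (left false p)
    p′ = toℕ p
    j′ = toℕ j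
    q : Vertex → Bool
    q x = edge (right b j) x ∧ ⌊ degreeOf x ℕ.≟ D ⌋
    row : ∀ a → count (q ∘ left a) ≡ bit (cross a b p′ j′)
    row a = trans (count-cong (λ i → cong (cross a b (toℕ i) j′ ∧_) (⌊≟⌋-injective _ leftDegree-injective i p)))
                  (count-point (λ i → cross a b (toℕ i) j′) p)
    far : ∀ b′ → count (q ∘ right b′) ≡ 0
    far b′ = trans (count-cong (λ j″ → ⌊≟⌋-≢ (<⇒≢ (leftDegree<rightDegree p j″) ∘ sym))) (count-false m)
    apex-far : count (q ∘ apex) ≡ 0
    apex-far = trans (count-cong {r} (λ _ → ⌊≟⌋-≢ (<⇒≢ (leftDegree<apex p) ∘ sym))) (count-false r)

  twins-differ : ∀ x → twin x ≡ x ⊎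
    ∃[ D ] (D ≢ degreeOf x × neighboursOfDegree x D ≢ neighboursOfDegree (twin x) D)
  twins-differ (apex _) = inj₁ refl
  twins-differ (left a i) with distinguishing-column (toℕ i) (toℕ<n i)
  ... | p , p<m , differs = inj₂ (degreeOf (right false P) , <⇒≢ (leftDegree<rightDegree i P) ∘ sym , differs′ a)
    where
    P = fromℕ< p<m
    differs′ : ∀ a → neighboursOfDegree (left a i) (degreeOf (right false P))
                   ≢ neighboursOfDegree (left (not a) i) (degreeOf (right false P))
    differs′ a rewrite neighboursOfDegree-left a i P | neighboursOfDegree-left (not a) i P | toℕ-fromℕ< p<m
      with a
    ... | false = differs
    ... | true  = differs ∘ sym
  twins-differ (right b j) with distinguishing-row (toℕ j) (toℕ<n j)
  ... | p , p<m , differs = inj₂ (degreeOf (left false P) , <⇒≢ (leftDegree<rightDegree P j) , differs′ b)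
    where
    P = fromℕ< p<m
    differs′ : ∀ b → neighboursOfDegree (right b j) (degreeOf (left false P))
                   ≢ neighboursOfDegree (right (not b) j) (degreeOf (left false P))
    differs′ b rewrite neighboursOfDegree-right b j P | neighboursOfDegree-right (not b) j P | toℕ-fromℕ< p<m
      with b
    ... | false = differs
    ... | true  = differs ∘ sym

  G-oblique : VertexOblique G
  G-oblique u v same-type with degreeOf-classes (decode u) (decode v) degrees
    where
    degrees : degreeOf (decode u) ≡ degreeOf (decode v)
    degrees = trans (sym (degree≡degreeOf u)) (trans (vertexType-≡⇒degree-≡ G {u} {v} same-type) (degree≡degreeOf v))
  ... | inj₁ v≡u = decode-injective (sym v≡u)
  ... | inj₂ v≡twin with twins-differ (decode u)
  ...   | inj₁ twin≡u = decode-injective (sym (trans v≡twin twin≡u))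
  ...   | inj₂ (D , D≢ , differs) =
    ⊥-elim (differs (trans (neighboursOfDegree-≡ {u} {v} same-type D D≢) (cong (λ x → neighboursOfDegree x D) v≡twin)))

  dually-oblique-split : Σ (Graph N) (λ H → DuallyVertexOblique H × IsSplit H)
  dually-oblique-split = G , (G-oblique , G-sameTypes) , G-split

zero-or-one≤1 : ∀ {r} → r ≡ 0 ⊎ r ≡ 1 → r ≤ 1
zero-or-one≤1 (inj₁ refl) = z≤n
zero-or-one≤1 (inj₂ refl) = s≤s z≤n

mainTheorem2 : (n : ℕ) → 12 ≤ n → (n % 4 ≡ 0 ⊎ n % 4 ≡ 1) →
    Σ (Graph n) (λ G → DuallyVertexOblique G × IsSplit G)
mainTheorem2 n 12≤n residue =
  subst (λ n → Σ (Graph n) (λ G → DuallyVertexOblique G × IsSplit G)) (sym n≡N)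
        (Construction.dually-oblique-split k (n % 4) (zero-or-one≤1 residue))
  where
  q = n / 4
  k = q ∸ 3
  m≡q : 3 + k ≡ q
  m≡q = m+[n∸m]≡n (/-monoˡ-≤ 4 12≤n)
  four-blocks : ∀ q r → r + q * 4 ≡ q + (q + (q + (q + r)))
  four-blocks = solve 2 (λ q r → r :+ q :* con 4 := q :+ (q :+ (q :+ (q :+ r)))) refl
    where open +-*-Solver
  n≡N : n ≡ Construction.N k (n % 4) (zero-or-one≤1 residue)
  n≡N = trans (m≡m%n+[m/n]*n n 4)
        (trans (four-blocks q (n % 4)) (cong (λ m → m + (m + (m + (m + n % 4)))) (sym m≡q)))
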